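{- Let $\{A,B,C\}$ be a $3$-coloring of a finite abelian group $G$ of odd order. Suppose there is a proper subgroup $H$ of $G$ and a color class, say $A$, such that: (i) $A\subseteq H$ and the $3$-coloring induced on $H$ is rainbow-free; (ii) both $\widetilde{B}=B\setminus H$ and $\widetilde{C}=C\setminus H$ are $H$-periodic; (iii) $\widetilde{B}=-\widetilde{B}=2\cdot\widetilde{B}$ and $\widetilde{C}=-\widetilde{C}=2\cdot\widetilde{C}$. Then the $3$-coloring is rainbow-free.
   Context: A $3$-coloring is a partition of $G$ into color classes $A,B,C$. A $3$-term arithmetic progression is a triple $(x,y,z)\in G^3$ with $x+y=2z$; it is rainbow if its members lie in pairwise distinct color classes; a coloring is rainbow-free if no rainbow progression exists. A set $S$ is $H$-periodic if $S+H=S$. $2\cdot X=\{2x:x\in X\}$, $-X=\{ -x:x\in X\}$. -}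

module Defs where

open import Level using (Level; _⊔_; suc)
open import Algebra.Bundles using (AbelianGroup)
open import Data.Nat using (ℕ)
open import Data.Nat.Divisibility using (_∣_)
open import Data.Fin using (Fin)
open import Data.Product using (Σ; ∃; _×_)
open import Relation.Nullary using (¬_)
open import Relation.Binary.PropositionalEquality as ≡ using (_≡_)
open import Function.Bundles using (Inverse)

module _ {c ℓ : Level} (G : AbelianGroup c ℓ) where
  open AbelianGroup G

  HasOrder : ℕ → Set (c ⊔ ℓ)
  HasOrder n = Inverse setoid (≡.setoid (Fin n))

  FiniteOddOrder : Set (c ⊔ ℓ)
  FiniteOddOrder = Σ ℕ λ n → HasOrder n × ¬ (2 ∣ n)

  Respects : {p : Level} → (Carrier → Set p) → Set (c ⊔ ℓ ⊔ p)
  Respects S = ∀ {x y} → x ≈ y → S x → S y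

  SetEq : {p q : Level} → (Carrier → Set p) → (Carrier → Set q) → Set (c ⊔ p ⊔ q)
  SetEq S T = ∀ g → (S g → T g) × (T g → S g)

  SumSet : {p q : Level} → (Carrier → Set p) → (Carrier → Set q) → Carrier → Set (c ⊔ ℓ ⊔ p ⊔ q)
  SumSet S T g = ∃ λ s → ∃ λ t → S s × T t × (g ≈ s ∙ t)

  NegSet : {p : Level} → (Carrier → Set p) → Carrier → Set (c ⊔ ℓ ⊔ p)
  NegSet S g = ∃ λ s → S s × (g ≈ s ⁻¹)

  DoubleSet : {p : Level} → (Carrier → Set p) → Carrier → Set (c ⊔ ℓ ⊔ p)
  DoubleSet S g = ∃ λ s → S s × (g ≈ s ∙ s)

  Periodic : {p q : Level} → (Carrier → Set p) → (Carrier → Set q) → Set (c ⊔ ℓ ⊔ p ⊔ q)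
  Periodic S H = SetEq (SumSet S H) S

  record IsSubgroup {p : Level} (H : Carrier → Set p) : Set (c ⊔ ℓ ⊔ p) where
    field
      resp  : Respects H
      ε-mem : H ε
      ∙-mem : ∀ {x y} → H x → H y → H (x ∙ y)
      ⁻¹-mem : ∀ {x} → H x → H (x ⁻¹)

  Proper : {p : Level} → (Carrier → Set p) → Set (c ⊔ p)
  Proper H = ∃ λ g → ¬ H g

  -- a 3-coloring: colour classes A = c⁻¹(0), B = c⁻¹(1), C = c⁻¹(2)
  IsColoring : (Carrier → Fin 3) → Set (c ⊔ ℓ)
  IsColoring col = ∀ {x y} → x ≈ y → col x ≡ col y

  IsAP : Carrier → Carrier → Carrier → Set ℓ
  IsAP x y z = x ∙ y ≈ z ∙ z

  Rainbow : (Carrier → Fin 3) → Carrier → Carrier → Carrier → Set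
  Rainbow col x y z = ¬ (col x ≡ col y) × ¬ (col y ≡ col z) × ¬ (col x ≡ col z)

  RainbowFreeOn : {p : Level} → (Carrier → Fin 3) → (Carrier → Set p) → Set (c ⊔ ℓ ⊔ p)
  RainbowFreeOn col X = ∀ x y z → X x → X y → X z → IsAP x y z → ¬ Rainbow col x y z

  RainbowFree : (Carrier → Fin 3) → Set (c ⊔ ℓ)
  RainbowFree col = ∀ x y z → IsAP x y z → ¬ Rainbow col x y z

  ClassOutside : {p : Level} → (Carrier → Fin 3) → Fin 3 → (Carrier → Set p) → Carrier → Set p
  ClassOutside col i H g = (col g ≡ i) × ¬ H g

-- Every rainbow progression x + y = 2z would have a term coloured A, hence in H. Outside H
-- the colour of an element is preserved by adding elements of H, by negation and by doubling.
-- If z ∈ H and x ∉ H, then y = -x + 2z has the colour of x; if x ∈ H and z ∉ H, then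
-- y = 2z - x has the colour of z; the case y ∈ H is the case x ∈ H with x and y swapped.
-- In the remaining cases two terms lie in H, hence so does the third, and the progression
-- lies in H, where the colouring is rainbow-free.
module Submission where

open import Defs
open import Level using (Level; _⊔_)
open import Algebra.Bundles using (AbelianGroup)
import Algebra.Properties.Group as GroupProperties
open import Data.Fin using (Fin; zero; suc)
open import Data.Product using (_,_; proj₁; proj₂)
open import Data.Sum using (_⊎_; inj₁; inj₂)
open import Data.Empty using (⊥-elim)
open import Relation.Nullary using (¬_; yes; no; ¬¬-excluded-middle)
open import Relation.Binary.PropositionalEquality as ≡ using (_≡_)

rainbow-hits-zero : (a b c : Fin 3) → ¬ a ≡ b → ¬ b ≡ c → ¬ a ≡ c →
  a ≡ zero ⊎ b ≡ zero ⊎ c ≡ zero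
rainbow-hits-zero zero _ _ _ _ _ = inj₁ ≡.refl
rainbow-hits-zero (suc _) zero _ _ _ _ = inj₂ (inj₁ ≡.refl)
rainbow-hits-zero (suc _) (suc _) zero _ _ _ = inj₂ (inj₂ ≡.refl)
rainbow-hits-zero (suc zero) (suc zero) (suc _) a≢b _ _ = ⊥-elim (a≢b ≡.refl)
rainbow-hits-zero (suc (suc zero)) (suc (suc zero)) (suc _) a≢b _ _ = ⊥-elim (a≢b ≡.refl)
rainbow-hits-zero (suc zero) (suc (suc zero)) (suc zero) _ _ a≢c = ⊥-elim (a≢c ≡.refl)
rainbow-hits-zero (suc zero) (suc (suc zero)) (suc (suc zero)) _ b≢c _ = ⊥-elim (b≢c ≡.refl)
rainbow-hits-zero (suc (suc zero)) (suc zero) (suc zero) _ b≢c _ = ⊥-elim (b≢c ≡.refl)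
rainbow-hits-zero (suc (suc zero)) (suc zero) (suc (suc zero)) _ _ a≢c = ⊥-elim (a≢c ≡.refl)

module _ {c ℓ : Level} (G : AbelianGroup c ℓ) where
  open AbelianGroup G renaming (refl to ≈-refl)
  open GroupProperties group using (y≈x\\z; x≈z//y)

  module _ {p : Level} {S : Carrier → Set p} where

    periodic⇒∙-closed : {q : Level} {H : Carrier → Set q} → Periodic G S H →
      ∀ {g h} → S g → H h → S (g ∙ h)
    periodic⇒∙-closed per Sg Hh = proj₁ (per _) (_ , _ , Sg , Hh , ≈-refl)

    symmetric⇒⁻¹-closed : SetEq G S (NegSet G S) → ∀ {g} → S g → S (g ⁻¹)
    symmetric⇒⁻¹-closed S≡-S Sg = proj₂ (S≡-S _) (_ , Sg , ≈-refl)

    doubling⇒double-closed : SetEq G S (DoubleSet G S) → ∀ {g} → S g → S (g ∙ g)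
    doubling⇒double-closed S≡2S Sg = proj₂ (S≡2S _) (_ , Sg , ≈-refl)

  IsAP-swap : ∀ {x y z} → IsAP G x y z → IsAP G y x z
  IsAP-swap ap = trans (comm _ _) ap

  Rainbow-swap : ∀ col {x y z} → Rainbow G col x y z → Rainbow G col y x z
  Rainbow-swap _ (x≢y , y≢z , x≢z) = (λ y≡x → x≢y (≡.sym y≡x)) , x≢z , y≢z

  record StableOutside {p : Level} (col : Carrier → Fin 3) (H : Carrier → Set p) (i : Fin 3)
         : Set (c ⊔ ℓ ⊔ p) where
    field
      periodic  : Periodic G (ClassOutside G col i H) H
      symmetric : SetEq G (ClassOutside G col i H) (NegSet G (ClassOutside G col i H))
      doubling  : SetEq G (ClassOutside G col i H) (DoubleSet G (ClassOutside G col i H))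

  stableOutside-everywhere : {p : Level} {col : Carrier → Fin 3} {H : Carrier → Set p} →
    (∀ g → col g ≡ zero → H g) →
    StableOutside col H (suc zero) → StableOutside col H (suc (suc zero)) →
    ∀ {g} → ¬ H g → StableOutside col H (col g)
  stableOutside-everywhere {col = col} A⊆H stable₁ stable₂ {g} g∉H with col g in colg
  ... | zero = ⊥-elim (g∉H (A⊆H g colg))
  ... | suc zero = stable₁
  ... | suc (suc zero) = stable₂

  module _ {p : Level} {col : Carrier → Fin 3} (col-resp : IsColoring G col)
           {H : Carrier → Set p} (H≤G : IsSubgroup G H)
           (stable : ∀ {g} → ¬ H g → StableOutside col H (col g)) where
    open IsSubgroup H≤G

    colour-centre : ∀ {x y z} → IsAP G x y z → H z → ¬ H x → col y ≡ col x
    colour-centre {x} {y} {z} ap Hz x∉H = ≡.trans (col-resp y≈-x+2z) (proj₁ -x+2z∈Sx)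
      where
      open StableOutside (stable x∉H)
      y≈-x+2z : y ≈ x ⁻¹ ∙ (z ∙ z)
      y≈-x+2z = y≈x\\z x y (z ∙ z) ap
      -x+2z∈Sx : ClassOutside G col (col x) H (x ⁻¹ ∙ (z ∙ z))
      -x+2z∈Sx = periodic⇒∙-closed periodic
        (symmetric⇒⁻¹-closed symmetric (≡.refl , x∉H)) (∙-mem Hz Hz)

    colour-end : ∀ {x y z} → IsAP G x y z → H x → ¬ H z → col y ≡ col z
    colour-end {x} {y} {z} ap Hx z∉H = ≡.trans (col-resp y≈2z-x) (proj₁ 2z-x∈Sz)
      where
      open StableOutside (stable z∉H)
      y≈2z-x : y ≈ (z ∙ z) ∙ x ⁻¹
      y≈2z-x = x≈z//y y x (z ∙ z) (IsAP-swap ap)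
      2z-x∈Sz : ClassOutside G col (col z) H ((z ∙ z) ∙ x ⁻¹)
      2z-x∈Sz = periodic⇒∙-closed periodic
        (doubling⇒double-closed doubling (≡.refl , z∉H)) (⁻¹-mem Hx)

    AP-closed : ∀ {x y z} → IsAP G x y z → H x → H z → H y
    AP-closed {x} {y} {z} ap Hx Hz =
      resp (sym (y≈x\\z x y (z ∙ z) ap)) (∙-mem (⁻¹-mem Hx) (∙-mem Hz Hz))

    module _ (rainbowFreeOnH : RainbowFreeOn G col H) where

      no-rainbow-centre∈H : ∀ {x y z} → IsAP G x y z → H z → ¬ Rainbow G col x y z
      no-rainbow-centre∈H {x} {y} {z} ap Hz rb@(x≢y , _ , _) = ¬¬-excluded-middle λ where
        (yes Hx) → rainbowFreeOnH x y z Hx (AP-closed ap Hx Hz) Hz ap rb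
        (no x∉H) → x≢y (≡.sym (colour-centre ap Hz x∉H))

      no-rainbow-end∈H : ∀ {x y z} → IsAP G x y z → H x → ¬ Rainbow G col x y z
      no-rainbow-end∈H {x} {y} {z} ap Hx rb@(_ , y≢z , _) = ¬¬-excluded-middle λ where
        (yes Hz) → rainbowFreeOnH x y z Hx (AP-closed ap Hx Hz) Hz ap rb
        (no z∉H) → y≢z (colour-end ap Hx z∉H)

      rainbowFree : (∀ g → col g ≡ zero → H g) → RainbowFree G col
      rainbowFree A⊆H x y z ap rb@(x≢y , y≢z , x≢z)
        with rainbow-hits-zero (col x) (col y) (col z) x≢y y≢z x≢z
      ... | inj₁ colx = no-rainbow-end∈H ap (A⊆H x colx) rb
      ... | inj₂ (inj₁ coly) = no-rainbow-end∈H (IsAP-swap ap) (A⊆H y coly) (Rainbow-swap col rb)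
      ... | inj₂ (inj₂ colz) = no-rainbow-centre∈H ap (A⊆H z colz) rb

proposition2 : {c ℓ p : Level} (G : AbelianGroup c ℓ) → FiniteOddOrder G →
    (col : AbelianGroup.Carrier G → Fin 3) → IsColoring G col →
    (H : AbelianGroup.Carrier G → Set p) → IsSubgroup G H → Proper G H →
    (∀ g → col g ≡ zero → H g) →
    RainbowFreeOn G col H →
    Periodic G (ClassOutside G col (suc zero) H) H →
    Periodic G (ClassOutside G col (suc (suc zero)) H) H →
    SetEq G (ClassOutside G col (suc zero) H) (NegSet G (ClassOutside G col (suc zero) H)) →
    SetEq G (ClassOutside G col (suc zero) H) (DoubleSet G (ClassOutside G col (suc zero) H)) →
    SetEq G (ClassOutside G col (suc (suc zero)) H) (NegSet G (ClassOutside G col (suc (suc zero)) H)) →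
    SetEq G (ClassOutside G col (suc (suc zero)) H) (DoubleSet G (ClassOutside G col (suc (suc zero)) H)) →
    RainbowFree G col
proposition2 G _ col col-resp H H≤G _ A⊆H rainbowFreeOnH perB perC negB dblB negC dblC =
  rainbowFree G col-resp H≤G
    (stableOutside-everywhere G A⊆H
      (record { periodic = perB ; symmetric = negB ; doubling = dblB })
      (record { periodic = perC ; symmetric = negC ; doubling = dblC }))
    rainbowFreeOnH A⊆H
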